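{- Let $n\ge1$ and let $\mathbb X$ be a multi-sorted topological structure in the signature of $\underset{\sim}{\mathbf M}_n$ that satisfies (A4) for all $1\le j<k\le n$ and all $x,y\in X_j$, $u,v\in X_k$: if $x\leqslant^jy$, $y\leqslant^{jk}u$, $u\leqslant^kv$ then $x\leqslant^{jk}v$; and (A5) for all $1\le j<k<\ell\le n$ and $x\in X_j$, $y\in X_k$, $z\in X_\ell$: if $x\leqslant^{jk}y$ and $y\leqslant^{k\ell}z$ then $x\leqslant^{j\ell}z$. Then $\mathbb X$ satisfies both (A6) $\langle X_k;\leqslant^k,\mathscr T_k\rangle$ is a Priestley space for every $k\in[0,n]$, and (A7) for all $1\le j<k\le n$ and $x\in X_j$, $y\in X_k$ with $x\not\leqslant^{jk}y$ there exist mutually increasing sets $U_j,\dots,U_k$, each $U_\ell$ a clopen up-set of $\langle X_\ell;\leqslant^\ell,\mathscr T_\ell\rangle$, with $x\in U_j$ and $y\in X_k\setminus U_k$, if and only if it satisfies all of: (A6)$^0$ $\langle X_0;\leqslant^0,\mathscr T_0\rangle$ is a Priestley space; (A6)$'$ $\leqslant^k$ is a partial order on $X_k$ for all $k\in[1,n]$; (A6)$''$ $\langle X_k;\mathscr T_k\rangle$ is compact for all $k\in[1,n]$; (A7)$'$ for all $j,k\in[1,n]$ with $j\le k$ and all $x\in X_j$, $y\in X_k$ with $x\not\leqslant^{jk}y$, there exist mutually increasing sets $U_j,U_{j+1},\dots,U_k$, each $U_\ell$ a clopen up-set of $\langle X_\ell;\leqslant^\ell,\mathscr T_\ell\rangle$,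 with $x\in U_j$ and $y\in X_k\setminus U_k$.
   Context: Fix $n\ge1$, $[m,p]=\{k\in\mathbb Z:m\le k\le p\}$. The signature of $\underset{\sim}{\mathbf M}_n$: a multi-sorted topological structure $\mathbb X$ in it consists of pairwise disjoint (possibly empty) sets $X_0,\dots,X_n$, maps $g_k\colon X_k\to X_0$ ($k\in[1,n]$), binary relations $\leqslant^k\subseteq X_k\times X_k$ ($k\in[0,n]$) and $\leqslant^{jk}\subseteq X_j\times X_k$ ($1\le j<k\le n$), and a topology $\mathscr T$ on $X_0\cup\dots\cup X_n$ which is the disjoint union of topologies $\mathscr T_k$ on the sets $X_k$ ($\mathscr T_k$ is the topology induced by $\mathscr T$ on $X_k$). A Priestley space is a compact ordered topological space in which, whenever $x\not\le y$, there is a clopen up-set containing $x$ but not $y$. Set $\leqslant^{kk}:=\leqslant^k$ for $k\in[1,n]$. For $j\le k$ in $[1,n]$ and $U_\ell\subseteq X_\ell$ ($\ell\in[j,k]$), the sets $U_j,\dots,U_k$ are mutually increasing if for all $i\le\ell$ in $[j,k]$, whenever $x\in U_i$, $y\in X_\ell$ and $x\leqslant^{i\ell}y$, then $y\in U_\ell$. -}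

module Defs where

open import Level using (0ℓ)
open import Data.Nat as ℕ using (ℕ)
open import Data.Fin using (Fin; _<_; _≤_; toℕ)
open import Data.Fin.Properties using (<-cmp; <-trans)
open import Data.List using (List)
open import Data.List.Relation.Unary.Any using (Any)
open import Data.Product using (Σ; ∃; _×_; _,_)
open import Data.Empty using (⊥)
open import Data.Unit using (⊤)
open import Relation.Nullary using (¬_)
open import Relation.Binary using (Rel; Tri; tri<; tri≈; tri>; IsPartialOrder)
open import Relation.Binary.PropositionalEquality using (_≡_; refl)

Subset : Set → Set₁
Subset X = X → Set

_≐_ : {X : Set} → Subset X → Subset X → Set
U ≐ V = ∀ x → (U x → V x) × (V x → U x)

record Topology (X : Set) : Set₁ where
  field
    IsOpen      : Subset X → Set
    open-ext    : ∀ {U V} → U ≐ V → IsOpen U → IsOpen V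
    open-univ   : IsOpen (λ _ → ⊤)
    open-⋃      : (I : Set) (U : I → Subset X) → (∀ i → IsOpen (U i)) →
                  IsOpen (λ x → Σ I (λ i → U i x))
    open-∩      : ∀ {U V} → IsOpen U → IsOpen V → IsOpen (λ x → U x × V x)
open Topology public

IsCompact : {X : Set} → Topology X → Set₁
IsCompact {X} T =
  (I : Set) (U : I → Subset X) → (∀ i → IsOpen T (U i)) →
  (∀ x → Σ I (λ i → U i x)) →
  Σ (List I) (λ is → ∀ x → Any (λ i → U i x) is)

IsClopen : {X : Set} → Topology X → Subset X → Set
IsClopen T U = IsOpen T U × IsOpen T (λ x → ¬ U x)

IsUpSet : {X : Set} → Rel X 0ℓ → Subset X → Set
IsUpSet _≤'_ U = ∀ {x y} → x ≤' y → U x → U y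

IsClopenUpSet : {X : Set} → Rel X 0ℓ → Topology X → Subset X → Set
IsClopenUpSet ≤' T U = IsClopen T U × IsUpSet ≤' U

IsPriestley : (X : Set) → Rel X 0ℓ → Topology X → Set₁
IsPriestley X _≤'_ T =
  IsCompact T × IsPartialOrder _≡_ _≤'_ ×
  (∀ x y → ¬ (x ≤' y) → Σ (Subset X) (λ U → IsClopenUpSet _≤'_ T U × U x × ¬ U y))

-- Sort X_0 is X0; sorts X_1..X_n are X k for k : Fin n (k standing for k+1).
-- Disjointness of the sorts is automatic (separate types); the topology on
-- the disjoint union is the disjoint union of the topologies T0, T k.

record MStructure (n : ℕ) : Set₁ where
  field
    X0   : Set
    X    : Fin n → Set
    T0   : Topology X0
    T    : (k : Fin n) → Topology (X k)
    g    : (k : Fin n) → X k → X0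
    ≤⁰   : Rel X0 0ℓ
    ≤ᵏ   : (k : Fin n) → Rel (X k) 0ℓ
    ≤ʲᵏ  : (j k : Fin n) → j < k → X j → X k → Set
open MStructure public

module _ {n : ℕ} (S : MStructure n) where

  ≤ᵢₗ : (i l : Fin n) → X S i → X S l → Set
  ≤ᵢₗ i l x y with <-cmp i l
  ... | tri< i<l _ _ = ≤ʲᵏ S i l i<l x y
  ... | tri≈ _ refl _ = ≤ᵏ S i x y
  ... | tri> _ _ _ = ⊥

  -- U_j,...,U_k mutually increasing (only the components U ℓ, j ≤ ℓ ≤ k, matter)
  MutuallyIncreasing : (j k : Fin n) → ((l : Fin n) → Subset (X S l)) → Set
  MutuallyIncreasing j k U =
    ∀ i l → j ≤ i → i ≤ l → l ≤ k →
    ∀ (x : X S i) (y : X S l) → U i x → ≤ᵢₗ i l x y → U l y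

  Separated : (j k : Fin n) → X S j → X S k → Set₁
  Separated j k x y =
    Σ ((l : Fin n) → Subset (X S l)) λ U →
      MutuallyIncreasing j k U ×
      (∀ l → j ≤ l → l ≤ k → IsClopenUpSet (≤ᵏ S l) (T S l) (U l)) ×
      U j x × ¬ U k y

  A4 : Set
  A4 = ∀ j k (p : j < k) (x y : X S j) (u v : X S k) →
       ≤ᵏ S j x y → ≤ʲᵏ S j k p y u → ≤ᵏ S k u v → ≤ʲᵏ S j k p x v

  A5 : Set
  A5 = ∀ j k l (p : j < k) (q : k < l) (x : X S j) (y : X S k) (z : X S l) →
       ≤ʲᵏ S j k p x y → ≤ʲᵏ S k l q y z → ≤ʲᵏ S j l (<-trans p q) x z

  A6 : Set₁
  A6 = IsPriestley (X0 S) (≤⁰ S) (T0 S) ×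
       (∀ k → IsPriestley (X S k) (≤ᵏ S k) (T S k))

  A7 : Set₁
  A7 = ∀ j k (p : j < k) (x : X S j) (y : X S k) →
       ¬ ≤ʲᵏ S j k p x y → Separated j k x y

  A6⁰ : Set₁
  A6⁰ = IsPriestley (X0 S) (≤⁰ S) (T0 S)

  A6′ : Set
  A6′ = ∀ k → IsPartialOrder _≡_ (≤ᵏ S k)

  A6″ : Set₁
  A6″ = ∀ k → IsCompact (T S k)

  A7′ : Set₁
  A7′ = ∀ j k → j ≤ k → (x : X S j) (y : X S k) →
        ¬ ≤ᵢₗ j k x y → Separated j k x y

-- With ≤^{kk} := ≤^k, condition (A7)′ for j < k is exactly (A7), while for
-- j = k it says that each ⟨X_k; ≤^k, 𝒯_k⟩ is totally order-disconnected: a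
-- family of mutually increasing sets U_k,…,U_k is just one clopen up-set U_k.
-- Together with (A6)⁰, (A6)′ and (A6)″ this is (A6) verbatim.
module Submission where

open import Level using (0ℓ)
open import Defs
open import Data.Nat using (ℕ; _≤_)
import Data.Nat.Properties as ℕ
open import Data.Fin as Fin using (Fin)
open import Data.Fin.Properties using (<-cmp; <-irrefl; <-irrelevant; ≤-antisym; ≤-refl)
open import Data.Product using (Σ; _×_; _,_; proj₁; proj₂)
open import Data.Empty using (⊥-elim)
open import Function.Bundles using (_⇔_; mk⇔)
open import Relation.Binary using (Rel; tri<; tri≈; tri>)
open import Relation.Binary.PropositionalEquality using (_≡_; refl; sym; subst)
open import Relation.Nullary using (¬_)

IsOrderSeparated : {X : Set} → Rel X 0ℓ → Topology X → Set₁
IsOrderSeparated {X} _≤'_ T =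
  ∀ x y → ¬ (x ≤' y) → Σ (Subset X) (λ U → IsClopenUpSet _≤'_ T U × U x × ¬ U y)

module _ {n : ℕ} (S : MStructure n) where

  ≤ᵢₗ-diag⇒≤ᵏ : ∀ k {x y} → ≤ᵢₗ S k k x y → ≤ᵏ S k x y
  ≤ᵢₗ-diag⇒≤ᵏ k with <-cmp k k
  ... | tri< k<k _ _ = ⊥-elim (<-irrefl refl k<k)
  ... | tri≈ _ refl _ = λ x≤y → x≤y
  ... | tri> _ _ k<k = ⊥-elim (<-irrefl refl k<k)

  ≤ᵢₗ-<⇒≤ʲᵏ : ∀ j k (j<k : j Fin.< k) {x y} → ≤ᵢₗ S j k x y → ≤ʲᵏ S j k j<k x y
  ≤ᵢₗ-<⇒≤ʲᵏ j k j<k {x} {y} with <-cmp j k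
  ... | tri< j<k′ _ _ = subst (λ p → ≤ʲᵏ S j k p x y) (<-irrelevant j<k′ j<k)
  ... | tri≈ _ refl _ = ⊥-elim (<-irrefl refl j<k)
  ... | tri> j≮k _ _ = ⊥-elim (j≮k j<k)

  concentrate : (k : Fin n) → Subset (X S k) → (l : Fin n) → Subset (X S l)
  concentrate k U l z = Σ (k ≡ l) λ k≡l → U (subst (X S) (sym k≡l) z)

  concentrate-self : ∀ k U {z} → concentrate k U k z → U z
  concentrate-self _ _ (refl , Uz) = Uz

  separated-diag : ∀ {k x y} U → IsClopenUpSet (≤ᵏ S k) (T S k) U →
                   U x → ¬ U y → Separated S k k x y
  separated-diag {k} U ((U-open , ∁U-open) , U-up) Ux ¬Uy =
    concentrate k U , increasing , clopen-up , (refl , Ux) , (λ Uy → ¬Uy (concentrate-self k U Uy))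
    where
    increasing : MutuallyIncreasing S k k (concentrate k U)
    increasing i l _ i≤l l≤k a b (refl , Ua) a≤b with ≤-antisym i≤l l≤k
    ... | refl = refl , U-up (≤ᵢₗ-diag⇒≤ᵏ k a≤b) Ua

    clopen-up : ∀ l → k Fin.≤ l → l Fin.≤ k →
                IsClopenUpSet (≤ᵏ S l) (T S l) (concentrate k U l)
    clopen-up l k≤l l≤k with ≤-antisym k≤l l≤k
    ... | refl =
      ( open-ext (T S k) (λ _ → (refl ,_) , concentrate-self k U) U-open
      , open-ext (T S k) (λ _ → (λ ¬Uz Uz → ¬Uz (concentrate-self k U Uz)) , (λ ¬Uz Uz → ¬Uz (refl , Uz)))
                 ∁U-open )
      , λ z≤w Uz → refl , U-up z≤w (concentrate-self k U Uz)

  A7′⇒A7 : A7′ S → A7 S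
  A7′⇒A7 a7′ j k j<k x y x≰y =
    a7′ j k (ℕ.<⇒≤ j<k) x y (λ x≤y → x≰y (≤ᵢₗ-<⇒≤ʲᵏ j k j<k x≤y))

  A7′⇒order-separated : A7′ S → ∀ k → IsOrderSeparated (≤ᵏ S k) (T S k)
  A7′⇒order-separated a7′ k x y x≰y
    with a7′ k k ≤-refl x y (λ x≤y → x≰y (≤ᵢₗ-diag⇒≤ᵏ k x≤y))
  ... | U , _ , clopen-up , Ux , ¬Uy = U k , clopen-up k ≤-refl ≤-refl , Ux , ¬Uy

  order-separated×A7⇒A7′ : (∀ k → IsOrderSeparated (≤ᵏ S k) (T S k)) → A7 S → A7′ S
  order-separated×A7⇒A7′ sep a7 j k j≤k x y x≰y with <-cmp j k
  ... | tri< j<k _ _ = a7 j k j<k x y x≰y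
  ... | tri≈ _ refl _ with sep j x y x≰y
  ...   | U , U-clopen-up , Ux , ¬Uy = separated-diag U U-clopen-up Ux ¬Uy
  order-separated×A7⇒A7′ sep a7 j k j≤k x y x≰y
      | tri> _ _ k<j = ⊥-elim (ℕ.≤⇒≯ j≤k k<j)

lemma4p3 : (n : ℕ) → 1 ≤ n → (S : MStructure n) → A4 S → A5 S →
    (A6 S × A7 S) ⇔ (A6⁰ S × A6′ S × A6″ S × A7′ S)
lemma4p3 n _ S _ _ = mk⇔ to from
  where
  to : A6 S × A7 S → A6⁰ S × A6′ S × A6″ S × A7′ S
  to ((priestley₀ , priestley) , a7) =
    priestley₀ , (λ k → proj₁ (proj₂ (priestley k))) , (λ k → proj₁ (priestley k)) ,
    order-separated×A7⇒A7′ S (λ k → proj₂ (proj₂ (priestley k))) a7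

  from : A6⁰ S × A6′ S × A6″ S × A7′ S → A6 S × A7 S
  from (priestley₀ , partial-order , compact , a7′) =
    (priestley₀ , λ k → compact k , partial-order k , A7′⇒order-separated S a7′ k) ,
    A7′⇒A7 S a7′
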